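{- Let $G$ be a nice graph with $\Delta(G)=2$. Then every edge-injective edge-weighting of $G$ with strictly positive weights is neighbour-sum-distinguishing.
   Context: All graphs are finite, simple, undirected and loopless. A graph is nice if none of its connected components is isomorphic to $K_2$. An edge-weighting of $G$ is a map $w:E(G)\to\mathbb{Z}_{>0}$; it is edge-injective if no two distinct edges receive the same weight. For a vertex $v$, $\sigma_w(v)=\sum_{u\in N(v)} w(vu)$; $w$ is neighbour-sum-distinguishing if $\sigma_w(u)\neq\sigma_w(v)$ for every edge $uv$. -}

module Defs where

open import Data.Nat using (ℕ; zero; suc; _<_; _≤_)
open import Data.Bool using (Bool; true; false; if_then_else_)
open import Data.Fin using (Fin)
open import Data.List using (List; map)
open import Data.Nat.ListAction using (sum)
open import Data.List.Base using (allFin)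
open import Data.Product using (Σ; ∃; _×_; _,_)
open import Data.Sum using (_⊎_)
open import Relation.Nullary using (¬_)
open import Relation.Binary.PropositionalEquality using (_≡_)

record Graph : Set where
  field
    n      : ℕ
    adj    : Fin n → Fin n → Bool
    sym    : ∀ u v → adj u v ≡ adj v u
    irrefl : ∀ v → adj v v ≡ false
open Graph public

Adj : (G : Graph) → Fin (n G) → Fin (n G) → Set
Adj G u v = adj G u v ≡ true

deg : (G : Graph) → Fin (n G) → ℕ
deg G v = sum (map (λ u → if adj G v u then 1 else 0) (allFin (n G)))

MaxDegreeIs : Graph → ℕ → Set
MaxDegreeIs G d = (∀ v → deg G v ≤ d) × ∃ (λ v → deg G v ≡ d)

data Reachable (G : Graph) : Fin (n G) → Fin (n G) → Set where
  here : ∀ {u} → Reachable G u u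
  step : ∀ {u v x} → Adj G u v → Reachable G v x → Reachable G u x

ComponentIsK2 : (G : Graph) → Fin (n G) → Set
ComponentIsK2 G u =
  Σ (Fin (n G)) λ v → Adj G u v × (∀ x → Reachable G u x → (x ≡ u ⊎ x ≡ v))

Nice : Graph → Set
Nice G = ∀ u → ¬ ComponentIsK2 G u

-- an edge-weighting: a weight for each (unordered) edge, given as a
-- function on vertex pairs symmetric on edges, positive on edges
-- (values on non-edges are irrelevant)
record Weighting (G : Graph) : Set where
  field
    w        : Fin (n G) → Fin (n G) → ℕ
    w-sym    : ∀ u v → Adj G u v → w u v ≡ w v u
    positive : ∀ u v → Adj G u v → 0 < w u v
open Weighting public

EdgeInjective : (G : Graph) → Weighting G → Set
EdgeInjective G ω = ∀ u v x y → Adj G u v → Adj G x y → w ω u v ≡ w ω x y →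
  (u ≡ x × v ≡ y) ⊎ (u ≡ y × v ≡ x)

σ : (G : Graph) → Weighting G → Fin (n G) → ℕ
σ G ω v = sum (map (λ u → if adj G v u then w ω v u else 0) (allFin (n G)))

NeighbourSumDistinguishing : (G : Graph) → Weighting G → Set
NeighbourSumDistinguishing G ω = ∀ u v → Adj G u v → ¬ (σ G ω u ≡ σ G ω v)

-- Let uv be an edge. Since Δ ≤ 2, each endpoint has at most one neighbour
-- besides the other endpoint. If neither has one, {u, v} is a K₂ component,
-- which niceness forbids. If exactly one of them, say v, has another
-- neighbour v', then σ(u) = w(uv) < w(uv) + w(vv') = σ(v) by positivity.
-- If u has u' and v has v', then σ(u) = σ(v) forces w(uu') = w(vv'), so by
-- edge-injectivity uu' and vv' are the same edge, impossible for u' ≠ v ≠ u.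
module Submission where

open import Defs hiding (sym)
open import Data.Nat using (ℕ; suc; _+_; _≤_; s≤s)
open import Data.Nat.Properties
  using (+-commutativeSemigroup; +-identityʳ; m≤m+n; +-monoʳ-≤; +-cancelˡ-≡; ≤-trans; m<m+n; <⇒≢)
open import Algebra.Properties.CommutativeSemigroup +-commutativeSemigroup using (x∙yz≈y∙xz)
open import Data.Bool using (true; false; if_then_else_)
import Data.Bool.Properties as Bool
open import Data.Fin using (Fin; zero; suc)
open import Data.Fin.Properties using (_≟_; any?)
open import Data.List using (map; tabulate; allFin)
open import Data.List.Properties using (map-tabulate)
open import Data.Nat.ListAction using (sum)
open import Data.Vec.Functional using (updateAt)
open import Data.Vec.Functional.Properties using (updateAt-updates; updateAt-minimal)
open import Data.Product using (_,_)
open import Data.Sum using (_⊎_; inj₁; inj₂; [_,_]′)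
open import Function using (_∘_; const; id)
open import Relation.Nullary using (¬_; yes; no; contradiction)
open import Relation.Nullary.Decidable using (¬?; _×-dec_)
open import Relation.Binary.PropositionalEquality
  using (_≡_; _≢_; refl; sym; trans; cong; cong₂; subst; subst₂; module ≡-Reasoning)

open ≡-Reasoning

sum-tabulate-zero : ∀ {n} (h : Fin n → ℕ) → (∀ k → h k ≡ 0) → sum (tabulate h) ≡ 0
sum-tabulate-zero {0}     h h≡0 = refl
sum-tabulate-zero {suc n} h h≡0 =
  cong₂ _+_ (h≡0 zero) (sum-tabulate-zero (h ∘ suc) (h≡0 ∘ suc))

sum-tabulate-updateAt : ∀ {n} (h : Fin n → ℕ) (i : Fin n) →
  sum (tabulate h) ≡ h i + sum (tabulate (updateAt h i (const 0)))
sum-tabulate-updateAt {suc n} h zero    = refl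
sum-tabulate-updateAt {suc n} h (suc i) = begin
  h zero + sum (tabulate (h ∘ suc))
    ≡⟨ cong (h zero +_) (sum-tabulate-updateAt (h ∘ suc) i) ⟩
  h zero + (h (suc i) + sum (tabulate (updateAt (h ∘ suc) i (const 0))))
    ≡⟨ x∙yz≈y∙xz (h zero) (h (suc i)) _ ⟩
  h (suc i) + (h zero + sum (tabulate (updateAt (h ∘ suc) i (const 0))))
    ∎

updateAt-zero-off : ∀ {n} (h : Fin n → ℕ) (i k : Fin n) →
  (k ≢ i → h k ≡ 0) → updateAt h i (const 0) k ≡ 0
updateAt-zero-off h i k h≡0 with k ≟ i
... | yes refl = updateAt-updates i h
... | no  k≢i  = trans (updateAt-minimal k i h k≢i) (h≡0 k≢i)

sum-tabulate-single : ∀ {n} (h : Fin n → ℕ) (i : Fin n) →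
  (∀ k → k ≢ i → h k ≡ 0) → sum (tabulate h) ≡ h i
sum-tabulate-single h i h≡0 = begin
  sum (tabulate h)                                   ≡⟨ sum-tabulate-updateAt h i ⟩
  h i + sum (tabulate (updateAt h i (const 0)))      ≡⟨ cong (h i +_) (sum-tabulate-zero _ rest≡0) ⟩
  h i + 0                                            ≡⟨ +-identityʳ (h i) ⟩
  h i                                                ∎
  where
  rest≡0 : ∀ k → updateAt h i (const 0) k ≡ 0
  rest≡0 k = updateAt-zero-off h i k (h≡0 k)

sum-tabulate-pair : ∀ {n} (h : Fin n → ℕ) (i j : Fin n) → i ≢ j →
  (∀ k → k ≢ i → k ≢ j → h k ≡ 0) → sum (tabulate h) ≡ h i + h j
sum-tabulate-pair h i j i≢j h≡0 = begin
  sum (tabulate h)                                   ≡⟨ sum-tabulate-updateAt h i ⟩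
  h i + sum (tabulate h′)                            ≡⟨ cong (h i +_) (sum-tabulate-single h′ j rest≡0) ⟩
  h i + h′ j                                         ≡⟨ cong (h i +_) (updateAt-minimal j i h (i≢j ∘ sym)) ⟩
  h i + h j                                          ∎
  where
  h′ = updateAt h i (const 0)
  rest≡0 : ∀ k → k ≢ j → h′ k ≡ 0
  rest≡0 k k≢j = updateAt-zero-off h i k (λ k≢i → h≡0 k k≢i k≢j)

≤-sum-tabulate : ∀ {n} (h : Fin n → ℕ) (i : Fin n) → h i ≤ sum (tabulate h)
≤-sum-tabulate h i rewrite sum-tabulate-updateAt h i = m≤m+n (h i) _

pair-≤-sum-tabulate : ∀ {n} (h : Fin n → ℕ) (i j : Fin n) → i ≢ j →
  h i + h j ≤ sum (tabulate h)
pair-≤-sum-tabulate h i j i≢j = subst (h i + h j ≤_) (sym (sum-tabulate-updateAt h i))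
  (+-monoʳ-≤ (h i) (subst (_≤ sum (tabulate h′)) (updateAt-minimal j i h (i≢j ∘ sym))
    (≤-sum-tabulate h′ j)))
  where
  h′ = updateAt h i (const 0)

triple-≤-sum-tabulate : ∀ {n} (h : Fin n → ℕ) (i j k : Fin n) → i ≢ j → i ≢ k → j ≢ k →
  h i + (h j + h k) ≤ sum (tabulate h)
triple-≤-sum-tabulate h i j k i≢j i≢k j≢k = subst (h i + (h j + h k) ≤_)
  (sym (sum-tabulate-updateAt h i))
  (+-monoʳ-≤ (h i) (subst (_≤ sum (tabulate h′))
    (cong₂ _+_ (updateAt-minimal j i h (i≢j ∘ sym)) (updateAt-minimal k i h (i≢k ∘ sym)))
    (pair-≤-sum-tabulate h′ j k j≢k)))
  where
  h′ = updateAt h i (const 0)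

Adj-sym : (G : Graph) {u v : Fin (n G)} → Adj G u v → Adj G v u
Adj-sym G {u} {v} uv = trans (Graph.sym G v u) uv

module _ (G : Graph) where

  private
    V = Fin (n G)

  -- deg G x and σ G ω x are this sum for f = const 1 and f = w ω x.
  neighbourSum : V → (V → ℕ) → ℕ
  neighbourSum x f = sum (map (λ k → if adj G x k then f k else 0) (allFin (n G)))

  module _ (x : V) (f : V → ℕ) where

    private
      term : V → ℕ
      term k = if adj G x k then f k else 0

      term-adj : ∀ k → Adj G x k → term k ≡ f k
      term-adj k xk rewrite xk = refl

      term-nonadj : ∀ k → ¬ Adj G x k → term k ≡ 0
      term-nonadj k ¬xk with adj G x k
      ... | true  = contradiction refl ¬xk
      ... | false = refl

    neighbourSum-tabulate : neighbourSum x f ≡ sum (tabulate term)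
    neighbourSum-tabulate = cong sum (map-tabulate id term)

    neighbourSum-single : ∀ y → Adj G x y → (∀ {k} → Adj G x k → k ≡ y) →
      neighbourSum x f ≡ f y
    neighbourSum-single y xy only-y = begin
      neighbourSum x f    ≡⟨ neighbourSum-tabulate ⟩
      sum (tabulate term) ≡⟨ sum-tabulate-single term y off-y ⟩
      term y              ≡⟨ term-adj y xy ⟩
      f y                 ∎
      where
      off-y : ∀ k → k ≢ y → term k ≡ 0
      off-y k k≢y = term-nonadj k (k≢y ∘ only-y)

    neighbourSum-pair : ∀ y y′ → y ≢ y′ → Adj G x y → Adj G x y′ →
      (∀ {k} → Adj G x k → k ≡ y ⊎ k ≡ y′) → neighbourSum x f ≡ f y + f y′
    neighbourSum-pair y y′ y≢y′ xy xy′ only-y-y′ = begin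
      neighbourSum x f      ≡⟨ neighbourSum-tabulate ⟩
      sum (tabulate term)   ≡⟨ sum-tabulate-pair term y y′ y≢y′ off-y-y′ ⟩
      term y + term y′      ≡⟨ cong₂ _+_ (term-adj y xy) (term-adj y′ xy′) ⟩
      f y + f y′            ∎
      where
      off-y-y′ : ∀ k → k ≢ y → k ≢ y′ → term k ≡ 0
      off-y-y′ k k≢y k≢y′ = term-nonadj k λ xk → [ k≢y , k≢y′ ]′ (only-y-y′ xk)

    neighbourSum-triple-≤ : ∀ i j k → i ≢ j → i ≢ k → j ≢ k →
      Adj G x i → Adj G x j → Adj G x k → f i + (f j + f k) ≤ neighbourSum x f
    neighbourSum-triple-≤ i j k i≢j i≢k j≢k xi xj xk = subst₂ _≤_
      (cong₂ _+_ (term-adj i xi) (cong₂ _+_ (term-adj j xj) (term-adj k xk)))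
      (sym neighbourSum-tabulate)
      (triple-≤-sum-tabulate term i j k i≢j i≢k j≢k)

  data NeighboursBesides (x y : V) : Set where
    none : (∀ {k} → Adj G x k → k ≡ y) → NeighboursBesides x y
    one  : ∀ y′ → y ≢ y′ → Adj G x y′ → (∀ {k} → Adj G x k → k ≡ y ⊎ k ≡ y′) →
           NeighboursBesides x y

  neighboursBesides : ∀ {x y} → deg G x ≤ 2 → Adj G x y → NeighboursBesides x y
  neighboursBesides {x} {y} deg≤2 xy with any? (λ k → ¬? (k ≟ y) ×-dec (adj G x k Bool.≟ true))
  ... | no ∄other = none only-y
    where
    only-y : ∀ {k} → Adj G x k → k ≡ y
    only-y {k} xk with k ≟ y
    ... | yes k≡y = k≡y
    ... | no  k≢y = contradiction (k , k≢y , xk) ∄other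
  ... | yes (y′ , y′≢y , xy′) = one y′ (y′≢y ∘ sym) xy′ only-y-y′
    where
    only-y-y′ : ∀ {k} → Adj G x k → k ≡ y ⊎ k ≡ y′
    only-y-y′ {k} xk with k ≟ y | k ≟ y′
    ... | yes k≡y | _        = inj₁ k≡y
    ... | no  _   | yes k≡y′ = inj₂ k≡y′
    ... | no  k≢y | no  k≢y′ = contradiction (≤-trans three≤deg deg≤2) λ { (s≤s (s≤s ())) }
      where
      three≤deg : 3 ≤ deg G x
      three≤deg = neighbourSum-triple-≤ x (const 1) y y′ k
        (y′≢y ∘ sym) (k≢y ∘ sym) (k≢y′ ∘ sym) xy xy′ xk

  isolatedEdge⇒ComponentIsK2 : ∀ {u v} → Adj G u v →
    (∀ {k} → Adj G u k → k ≡ v) → (∀ {k} → Adj G v k → k ≡ u) → ComponentIsK2 G u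
  isolatedEdge⇒ComponentIsK2 {u} {v} uv only-v only-u = v , uv , λ x → stays (inj₁ refl)
    where
    stays : ∀ {s x} → s ≡ u ⊎ s ≡ v → Reachable G s x → x ≡ u ⊎ x ≡ v
    stays s∈uv          here       = s∈uv
    stays (inj₁ refl) (step sk r) = stays (inj₂ (only-v sk)) r
    stays (inj₂ refl) (step sk r) = stays (inj₁ (only-u sk)) r

  module _ (ω : Weighting G) where

    leaf-fork-σ-distinct : ∀ {x y} y′ → Adj G x y → (∀ {k} → Adj G x k → k ≡ y) →
      x ≢ y′ → Adj G y y′ → (∀ {k} → Adj G y k → k ≡ x ⊎ k ≡ y′) → σ G ω x ≢ σ G ω y
    leaf-fork-σ-distinct {x} {y} y′ xy only-y x≢y′ yy′ only-x-y′ σx≡σy =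
      <⇒≢ (m<m+n (w ω y x) (positive ω y y′ yy′)) (begin
        w ω y x                ≡⟨ w-sym ω y x (Adj-sym G xy) ⟩
        w ω x y                ≡⟨ neighbourSum-single x (w ω x) y xy only-y ⟨
        σ G ω x                ≡⟨ σx≡σy ⟩
        σ G ω y                ≡⟨ neighbourSum-pair y (w ω y) x y′ x≢y′ (Adj-sym G xy) yy′ only-x-y′ ⟩
        w ω y x + w ω y y′     ∎)

    fork-fork-σ-distinct : EdgeInjective G ω → ∀ {u v} u′ v′ → Adj G u v →
      v ≢ u′ → Adj G u u′ → (∀ {k} → Adj G u k → k ≡ v ⊎ k ≡ u′) →
      u ≢ v′ → Adj G v v′ → (∀ {k} → Adj G v k → k ≡ u ⊎ k ≡ v′) → σ G ω u ≢ σ G ω v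
    fork-fork-σ-distinct inj {u} {v} u′ v′ uv v≢u′ uu′ only-v-u′ u≢v′ vv′ only-u-v′ σu≡σv
      with inj u u′ v v′ uu′ vv′ wuu′≡wvv′
      where
      wuu′≡wvv′ : w ω u u′ ≡ w ω v v′
      wuu′≡wvv′ = +-cancelˡ-≡ (w ω u v) _ _ (begin
        w ω u v + w ω u u′     ≡⟨ neighbourSum-pair u (w ω u) v u′ v≢u′ uv uu′ only-v-u′ ⟨
        σ G ω u                ≡⟨ σu≡σv ⟩
        σ G ω v                ≡⟨ neighbourSum-pair v (w ω v) u v′ u≢v′ (Adj-sym G uv) vv′ only-u-v′ ⟩
        w ω v u + w ω v v′     ≡⟨ cong (_+ w ω v v′) (w-sym ω v u (Adj-sym G uv)) ⟩
        w ω u v + w ω v v′     ∎)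
    ... | inj₁ (refl , _) = contradiction (trans (sym uv) (irrefl G u)) λ ()
    ... | inj₂ (u≡v′ , _) = u≢v′ u≡v′

mainTheorem4 : (G : Graph) → Nice G → MaxDegreeIs G 2 →
    (ω : Weighting G) → EdgeInjective G ω → NeighbourSumDistinguishing G ω
mainTheorem4 G nice (deg≤2 , _) ω inj u v uv
  with neighboursBesides G (deg≤2 u) uv | neighboursBesides G (deg≤2 v) (Adj-sym G uv)
... | none only-v | none only-u =
  λ _ → nice u (isolatedEdge⇒ComponentIsK2 G uv only-v only-u)
... | none only-v | one v′ u≢v′ vv′ only-u-v′ =
  leaf-fork-σ-distinct G ω v′ uv only-v u≢v′ vv′ only-u-v′
... | one u′ v≢u′ uu′ only-v-u′ | none only-u =
  leaf-fork-σ-distinct G ω u′ (Adj-sym G uv) only-u v≢u′ uu′ only-v-u′ ∘ sym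
... | one u′ v≢u′ uu′ only-v-u′ | one v′ u≢v′ vv′ only-u-v′ =
  fork-fork-σ-distinct G ω inj u′ v′ uv v≢u′ uu′ only-v-u′ u≢v′ vv′ only-u-v′
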